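{- For every integer $r\ge 1$ let $\mathscr{P}_{C_r}(q)$ be the $q$-analog of Kostant's partition function evaluated at the highest root of type $C_r$ (defined in the context). Then, as formal power series in $x$ with coefficients in $\mathbb{Z}[q]$, \[ \sum_{r\geq 1}\mathscr{P}_{C_r}(q)x^r=\frac{qx+(-q-q^2)x^2}{1-(2+2q+q^2)x+(1+2q+q^2+q^3)x^2}. \]
   Context: Type $C_r$ (the Lie algebra $\mathfrak{sp}_{2r}(\mathbb{C})$), $r\ge1$: with simple roots $\alpha_1,\dots,\alpha_r$ (where $\alpha_r$ is the long simple root), the positive roots are $\alpha_i+\alpha_{i+1}+\cdots+\alpha_j$ for $1\le i\le j\le r$; $\alpha_i+\cdots+\alpha_{j-1}+2\alpha_j+\cdots+2\alpha_{r-1}+\alpha_r$ for $1\le i<j\le r-1$; and $2\alpha_i+2\alpha_{i+1}+\cdots+2\alpha_{r-1}+\alpha_r$ for $1\le i\le r-1$. The highest root is $\tilde\alpha=2\alpha_1+2\alpha_2+\cdots+2\alpha_{r-1}+\alpha_r$ (for $r=1$ it is $\alpha_1$). A partition of $\tilde\alpha$ with $k$ parts is a multiset of $k$ positive roots (repetitions allowed) summing to $\tilde\alpha$. Then $\mathscr{P}_{C_r}(q)=\sum_{k\ge1}a_kq^k$, where $a_k$ is the number of partitions of $\tilde\alpha$ with exactly $k$ parts. -}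

module Defs where

open import Data.Nat as ℕ using (ℕ; zero; suc; _∸_; _≤ᵇ_; _<ᵇ_; _≡ᵇ_)
open import Data.Bool using (Bool; true; false; if_then_else_; _∧_)
open import Data.Fin using (Fin; toℕ)
open import Data.List as L using (List; []; _∷_; _++_; concatMap; upTo; length; filterᵇ)
open import Data.Vec as V using (Vec; tabulate; replicate; zipWith)
open import Data.Vec.Properties using (≡-dec)
open import Data.Integer as ℤ using (ℤ; +_; -_)
open import Relation.Nullary.Decidable using (⌊_⌋)
open import Data.Nat.ListAction using (sum)

-- Roots of type C_r, written in the basis of simple roots α_1..α_r.
-- A root is its coefficient vector: position p (p = 0..r-1) holds the
-- coefficient of α_{p+1}.

Root : ℕ → Set
Root r = Vec ℕ r

coeffs : (r : ℕ) → (ℕ → ℕ) → Root r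
coeffs r f = tabulate (λ (p : Fin r) → f (suc (toℕ p)))

-- α_i + ... + α_j   (1 ≤ i ≤ j ≤ r)
root₁ : (r i j : ℕ) → Root r
root₁ r i j = coeffs r (λ l → if (i ≤ᵇ l) ∧ (l ≤ᵇ j) then 1 else 0)

-- α_i + ... + α_{j-1} + 2α_j + ... + 2α_{r-1} + α_r   (1 ≤ i < j ≤ r-1)
root₂ : (r i j : ℕ) → Root r
root₂ r i j = coeffs r (λ l →
  if l ≡ᵇ r then 1
  else if (j ≤ᵇ l) then 2
  else if (i ≤ᵇ l) then 1 else 0)

-- 2α_i + ... + 2α_{r-1} + α_r   (1 ≤ i ≤ r-1)
root₃ : (r i : ℕ) → Root r
root₃ r i = coeffs r (λ l →
  if l ≡ᵇ r then 1
  else if (i ≤ᵇ l) then 2 else 0)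

-- [a, a+1, ..., b]  (empty if b < a)
range : ℕ → ℕ → List ℕ
range a b = L.map (λ t → a ℕ.+ t) (upTo (suc b ∸ a))

positiveRoots : (r : ℕ) → List (Root r)
positiveRoots r =
     concatMap (λ i → L.map (λ j → root₁ r i j) (range i r)) (range 1 r)
  ++ concatMap (λ i → L.map (λ j → root₂ r i j) (range (suc i) (r ∸ 1))) (range 1 (r ∸ 1))
  ++ L.map (λ i → root₃ r i) (range 1 (r ∸ 1))

highestRoot : (r : ℕ) → Root r
highestRoot r = coeffs r (λ l → if l ≡ᵇ r then 1 else 2)

-- A multiset of positive roots is a multiplicity function on the list of
-- positive roots. With k parts, every multiplicity is ≤ k, so all such
-- multisets appear in the finite list below.

boundedLists : (n b : ℕ) → List (List ℕ)
boundedLists zero    b = [] ∷ []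
boundedLists (suc n) b = concatMap (λ m → L.map (m ∷_) (boundedLists n b)) (upTo (suc b))

combine : {r : ℕ} → List ℕ → List (Root r) → Root r
combine {r} (m ∷ ms) (ρ ∷ ρs) = zipWith ℕ._+_ (V.map (m ℕ.*_) ρ) (combine ms ρs)
combine {r} _        _        = replicate r 0

partitionCount : (r k : ℕ) → ℕ
partitionCount r k =
  length (filterᵇ isPartition
           (boundedLists (length (positiveRoots r)) k))
  where
  isPartition : List ℕ → Bool
  isPartition ms = (sum ms ≡ᵇ k)
                 ∧ ⌊ ≡-dec ℕ._≟_ (combine ms (positiveRoots r)) (highestRoot r) ⌋

-- Formal power series in x over ℤ[q], as coefficient arrays:
-- S n k = coefficient of x^n q^k.

Series : Set
Series = ℕ → ℕ → ℤ

Σℤ : ℕ → (ℕ → ℤ) → ℤ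
Σℤ zero    f = f 0
Σℤ (suc n) f = Σℤ n f ℤ.+ f (suc n)

_⊛_ : Series → Series → Series
(F ⊛ G) n k = Σℤ n (λ i → Σℤ k (λ j → F i j ℤ.* G (n ∸ i) (k ∸ j)))

-- Σ_{r≥1} P_{C_r}(q) x^r,  with P_{C_r}(q) = Σ_{k≥1} a_k q^k
kostantSeries : Series
kostantSeries zero    k       = + 0
kostantSeries (suc r) zero    = + 0
kostantSeries (suc r) (suc k) = + partitionCount (suc r) (suc k)

numerator : Series
numerator 1 1 = + 1
numerator 2 1 = - (+ 1)
numerator 2 2 = - (+ 1)
numerator _ _ = + 0

denominator : Series
denominator 0 0 = + 1
denominator 1 0 = - (+ 2)
denominator 1 1 = - (+ 2)
denominator 1 2 = - (+ 1)
denominator 2 0 = + 1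
denominator 2 1 = + 2
denominator 2 2 = + 1
denominator 2 3 = + 1
denominator _ _ = + 0

module Submission where

-- The proof follows the recursive structure of the positive roots of C_r.
--
-- Up to permutation,
-- the positive roots of C_{n+2} are the roots 1 ∷ a for the "tails"
-- a ∈ {0} ∪ {roots of C_{n+1} with positive α₁-coefficient}, the highest
-- root 2 ∷ h, and the roots 0 ∷ ρ of C_{n+1}.  Sorting the parts of a
-- partition by their α₁-coefficient gives, for P(n) = P_{C_{n+1}}(q) and the
-- numbers W(n), O(n) of completions of unordered, resp. ordered, pairs of
-- tails:
--   P(n+1) = q + q² W(n),
--   W(n+1) = P(n+1) + q O(n) + 1 + W(n),
--   O(n+1) = P(n+1) + 2q O(n) + 2 + O(n).
--
-- Over ℤ, with multiplication by q acting as a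
-- shift of coefficient sequences, eliminating W and O gives
--   P(m+2) = (2 + 2q + q²) P(m+1) − (1 + 2q + q² + q³) P(m),
-- so (Σ_m P(m) x^{m+1}) times the denominator has no terms beyond x²; the
-- coefficients of x and x² are computed directly.

open import Defs
open import Data.Nat using (ℕ)
open import Relation.Binary.PropositionalEquality using (_≡_; trans)

module Counting where

  open import Function using (_∘_)
  open import Data.Nat as Nat using (ℕ; zero; suc; _+_; _*_; _∸_; _≡ᵇ_; _≤_; z≤n; s≤s)
  open import Data.Nat.Properties using (+-comm; +-assoc; +-identityʳ; ∸-+-assoc; m∸n≤m; ≤-trans; ≤-refl; n∸n≡0)
  import Data.Nat.Tactic.RingSolver as ℕ-Solver
  open import Data.Nat.ListAction using (sum)
  open import Data.Bool using (Bool; true; false; if_then_else_; _∧_)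
  open import Data.Vec as V using ([]; _∷_; zipWith; replicate)
  open import Data.Vec.Properties using (≡-dec; zipWith-comm)
  open import Data.List as L using (List; []; _∷_; _++_; length; filterᵇ; concatMap; applyUpTo; upTo)
  open import Data.List.Properties using (map-∘; map-cong; map-id; map-upTo; concatMap-map; concatMap-cong; map-concatMap; map-++; ++-assoc)
  open import Data.List.Relation.Binary.Permutation.Propositional as Perm using (_↭_; ↭-refl; ↭-sym; module PermutationReasoning)
  open import Data.List.Relation.Binary.Permutation.Propositional.Properties using (++⁺; ++⁺ˡ; ++⁺ʳ; map⁺; shift; shifts)
  open import Relation.Nullary.Decidable using (⌊_⌋; isYes≗does)
  open import Relation.Binary.PropositionalEquality

  private variable
    r : ℕ

  -- Boolean order on ℕ, structural in both arguments.
  _≤b_ : ℕ → ℕ → Bool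
  zero  ≤b n     = true
  suc m ≤b zero  = false
  suc m ≤b suc n = m ≤b n

  _≤v_ : Root r → Root r → Bool
  []       ≤v []       = true
  (x ∷ xs) ≤v (y ∷ ys) = (x ≤b y) ∧ (xs ≤v ys)

  _+v_ _-v_ : Root r → Root r → Root r
  _+v_ = zipWith _+_
  _-v_ = zipWith _∸_

  0v : Root r
  0v {r} = replicate r 0

  isZero : Root r → Bool
  isZero []       = true
  isZero (x ∷ xs) = (x ≤b 0) ∧ isZero xs

  infixr 7 _⊙_
  _⊙_ : Bool → ℕ → ℕ
  b ⊙ x = if b then x else 0

  ⊙-∧ : ∀ a b x → a ⊙ b ⊙ x ≡ (a ∧ b) ⊙ x
  ⊙-∧ true  b x = refl
  ⊙-∧ false b x = refl

  ⊙-+ : ∀ b x y → b ⊙ (x + y) ≡ b ⊙ x + b ⊙ y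
  ⊙-+ true  x y = refl
  ⊙-+ false x y = refl

  ⊙-0 : ∀ b → b ⊙ 0 ≡ 0
  ⊙-0 true  = refl
  ⊙-0 false = refl

  ∧-interchange : ∀ a b c d → (a ∧ b) ∧ (c ∧ d) ≡ (a ∧ c) ∧ (b ∧ d)
  ∧-interchange true  true  c d = refl
  ∧-interchange true  false c d with c
  ... | true  = refl
  ... | false = refl
  ∧-interchange false b     c d = refl

  ≤b-+ : ∀ x y t → ((x ≤b t) ∧ (y ≤b (t ∸ x))) ≡ ((x + y) ≤b t)
  ≤b-+ zero    y t       = refl
  ≤b-+ (suc x) y zero    = refl
  ≤b-+ (suc x) y (suc t) = ≤b-+ x y t

  ≤v-+ : (x y t : Root r) → ((x ≤v t) ∧ (y ≤v (t -v x))) ≡ ((x +v y) ≤v t)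
  ≤v-+ []       []       []       = refl
  ≤v-+ (x ∷ xs) (y ∷ ys) (t ∷ ts) =
    trans (∧-interchange (x ≤b t) (xs ≤v ts) (y ≤b (t ∸ x)) (ys ≤v (ts -v xs)))
          (cong₂ _∧_ (≤b-+ x y t) (≤v-+ xs ys ts))

  -v-+ : (x y t : Root r) → (t -v x) -v y ≡ t -v (x +v y)
  -v-+ []       []       []       = refl
  -v-+ (x ∷ xs) (y ∷ ys) (t ∷ ts) = cong₂ _∷_ (∸-+-assoc t x y) (-v-+ xs ys ts)

  +v-comm : (x y : Root r) → x +v y ≡ y +v x
  +v-comm = zipWith-comm +-comm

  0v-≤v : (t : Root r) → (0v ≤v t) ≡ true
  0v-≤v []      = refl
  0v-≤v (x ∷ t) = 0v-≤v t

  -v-0v : (t : Root r) → t -v 0v ≡ t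
  -v-0v []      = refl
  -v-0v (x ∷ t) = cong (x ∷_) (-v-0v t)

  ≤v-refl : (t : Root r) → (t ≤v t) ≡ true
  ≤v-refl []      = refl
  ≤v-refl (x ∷ t) = cong₂ _∧_ (≤b-refl x) (≤v-refl t)
    where
    ≤b-refl : ∀ x → (x ≤b x) ≡ true
    ≤b-refl zero    = refl
    ≤b-refl (suc x) = ≤b-refl x

  -v-self : (t : Root r) → t -v t ≡ 0v
  -v-self []      = refl
  -v-self (x ∷ t) = cong₂ _∷_ (n∸n≡0 x) (-v-self t)

  guard-comm : (x y t : Root r) → ((x ≤v t) ∧ (y ≤v (t -v x))) ≡ ((y ≤v t) ∧ (x ≤v (t -v y)))
  guard-comm x y t = trans (≤v-+ x y t) (trans (cong (_≤v t) (+v-comm x y)) (sym (≤v-+ y x t)))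

  sub-comm : (x y t : Root r) → (t -v x) -v y ≡ (t -v y) -v x
  sub-comm x y t = trans (-v-+ x y t) (trans (cong (t -v_) (+v-comm x y)) (sym (-v-+ y x t)))

  -- ways L t k: the number of multisets of k entries of L with sum t (equal
  -- entries at different positions of L count as different elements).  A
  -- multiset either avoids the head ρ or contains it at least once.
  ways : List (Root r) → Root r → ℕ → ℕ
  ways []      t zero    = isZero t ⊙ 1
  ways []      t (suc k) = 0
  ways (ρ ∷ L) t zero    = ways L t zero
  ways (ρ ∷ L) t (suc k) = ways L t (suc k) + (ρ ≤v t) ⊙ ways (ρ ∷ L) (t -v ρ) k

  ways-zero : ∀ (L : List (Root r)) t → ways L t 0 ≡ isZero t ⊙ 1
  ways-zero []      t = refl
  ways-zero (ρ ∷ L) t = ways-zero L t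

  -- Swapping the first two elements, one step of the induction on k:
  -- both sides split as "avoid both / use only one of them / use u and then v",
  -- and the last part is symmetric by the hypothesis at k.
  ways-swap-step : ∀ (x y : Root r) L t k
    → (∀ u v s → ways (u ∷ v ∷ L) s (suc k) ≡ ways (v ∷ u ∷ L) s (suc k))
    → (∀ u v s → ways (u ∷ v ∷ L) s k ≡ ways (v ∷ u ∷ L) s k)
    → ways (x ∷ y ∷ L) t (suc (suc k)) ≡ ways (y ∷ x ∷ L) t (suc (suc k))
  ways-swap-step x y L t k swap-suc swap = begin
      (A + gy) + (x ≤v t) ⊙ ways (x ∷ y ∷ L) (t -v x) (suc k)
    ≡⟨ cong ((A + gy) +_) (split x y) ⟩
      (A + gy) + (gx + both x y)
    ≡⟨ cong (λ w → (A + gy) + (gx + w)) both-comm ⟩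
      (A + gy) + (gx + both y x)
    ≡⟨ interchange A gy gx (both y x) ⟩
      (A + gx) + (gy + both y x)
    ≡⟨ cong ((A + gx) +_) (sym (split y x)) ⟩
      (A + gx) + (y ≤v t) ⊙ ways (y ∷ x ∷ L) (t -v y) (suc k) ∎
    where
    open ≡-Reasoning
    A gx gy : ℕ
    A  = ways L t (suc (suc k))
    gx = (x ≤v t) ⊙ ways (x ∷ L) (t -v x) (suc k)
    gy = (y ≤v t) ⊙ ways (y ∷ L) (t -v y) (suc k)
    -- multisets using u first and then v
    both : Root _ → Root _ → ℕ
    both u v = ((u ≤v t) ∧ (v ≤v (t -v u))) ⊙ ways (v ∷ u ∷ L) ((t -v u) -v v) k
    split : ∀ u v → (u ≤v t) ⊙ ways (u ∷ v ∷ L) (t -v u) (suc k)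
                  ≡ (u ≤v t) ⊙ ways (u ∷ L) (t -v u) (suc k) + both u v
    split u v =
      trans (cong ((u ≤v t) ⊙_) (swap-suc u v (t -v u)))
      (trans (⊙-+ (u ≤v t) _ _) (cong (_ +_) (⊙-∧ (u ≤v t) _ _)))
    both-comm : both x y ≡ both y x
    both-comm = cong₂ _⊙_ (guard-comm x y t)
      (trans (swap y x ((t -v x) -v y)) (cong (λ s → ways (x ∷ y ∷ L) s k) (sub-comm x y t)))
    interchange : ∀ a b c d → (a + b) + (c + d) ≡ (a + c) + (b + d)
    interchange = ℕ-Solver.solve-∀

  ways-swap : ∀ (x y : Root r) L t k → ways (x ∷ y ∷ L) t k ≡ ways (y ∷ x ∷ L) t k
  ways-swap x y L t zero          = refl
  ways-swap x y L t (suc zero)    =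
    swap₂₃ (ways L t 1) ((y ≤v t) ⊙ ways L (t -v y) 0) ((x ≤v t) ⊙ ways L (t -v x) 0)
    where
    swap₂₃ : ∀ a b c → a + b + c ≡ a + c + b
    swap₂₃ = ℕ-Solver.solve-∀
  ways-swap x y L t (suc (suc k)) =
    ways-swap-step x y L t k (λ u v s → ways-swap u v L s (suc k)) (λ u v s → ways-swap u v L s k)

  ways-prep : ∀ (x : Root r) {L L′} → (∀ t k → ways L t k ≡ ways L′ t k)
            → ∀ t k → ways (x ∷ L) t k ≡ ways (x ∷ L′) t k
  ways-prep x e t zero    = e t zero
  ways-prep x e t (suc k) = cong₂ _+_ (e t (suc k)) (cong ((x ≤v t) ⊙_) (ways-prep x e (t -v x) k))

  ways-↭ : {L L′ : List (Root r)} → L ↭ L′ → ∀ t k → ways L t k ≡ ways L′ t k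
  ways-↭ Perm.refl              t k = refl
  ways-↭ (Perm.prep x p)        t k = ways-prep x (ways-↭ p) t k
  ways-↭ (Perm.swap {xs} x y p) t k = trans (ways-swap x y xs t k) (ways-prep y (ways-prep x (ways-↭ p)) t k)
  ways-↭ (Perm.trans p q)       t k = trans (ways-↭ p t k) (ways-↭ q t k)

  Σ≤ : ℕ → (ℕ → ℕ) → ℕ
  Σ≤ zero    f = f 0
  Σ≤ (suc k) f = f 0 + Σ≤ k (λ m → f (suc m))

  Σ≤-cong : ∀ {f g} k → (∀ m → f m ≡ g m) → Σ≤ k f ≡ Σ≤ k g
  Σ≤-cong zero    e = e 0
  Σ≤-cong (suc k) e = cong₂ _+_ (e 0) (Σ≤-cong k (λ m → e (suc m)))

  ⊙-Σ≤ : ∀ b f k → b ⊙ Σ≤ k f ≡ Σ≤ k (λ m → b ⊙ f m)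
  ⊙-Σ≤ true  f k       = refl
  ⊙-Σ≤ false f zero    = refl
  ⊙-Σ≤ false f (suc k) = ⊙-Σ≤ false (λ m → f (suc m)) k

  Σ≤-truncate : ∀ B k f → k ≤ B → Σ≤ B (λ m → (m ≤b k) ⊙ f m) ≡ Σ≤ k f
  Σ≤-truncate zero    zero    f z≤n      = refl
  Σ≤-truncate (suc B) zero    f z≤n      = trans (cong (f 0 +_) (Σ≤-zero B)) (+-identityʳ _)
    where
    Σ≤-zero : ∀ B → Σ≤ B (λ _ → 0) ≡ 0
    Σ≤-zero zero    = refl
    Σ≤-zero (suc B) = Σ≤-zero B
  Σ≤-truncate (suc B) (suc k) f (s≤s le) = cong (f 0 +_) (Σ≤-truncate B k (λ m → f (suc m)) le)

  scale : ℕ → Root r → Root r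
  scale m ρ = V.map (m *_) ρ

  scale-0 : (ρ : Root r) → scale 0 ρ ≡ 0v
  scale-0 []      = refl
  scale-0 (x ∷ ρ) = cong (0 ∷_) (scale-0 ρ)

  scale-suc : ∀ m (ρ : Root r) → scale (suc m) ρ ≡ ρ +v scale m ρ
  scale-suc m []      = refl
  scale-suc m (x ∷ ρ) = cong (_ ∷_) (scale-suc m ρ)

  multiplicity-zero : ∀ (ρ : Root r) L t k → ways L t k ≡ (scale 0 ρ ≤v t) ⊙ ways L (t -v scale 0 ρ) k
  multiplicity-zero ρ L t k rewrite scale-0 ρ | 0v-≤v t | -v-0v t = refl

  ways-multiplicity : ∀ (ρ : Root r) L t k →
    ways (ρ ∷ L) t k ≡ Σ≤ k (λ m → (scale m ρ ≤v t) ⊙ ways L (t -v scale m ρ) (k ∸ m))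
  ways-multiplicity ρ L t zero    = multiplicity-zero ρ L t zero
  ways-multiplicity ρ L t (suc k) =
    cong₂ _+_ (multiplicity-zero ρ L t (suc k))
      (trans (cong ((ρ ≤v t) ⊙_) (ways-multiplicity ρ L (t -v ρ) k))
      (trans (⊙-Σ≤ (ρ ≤v t) _ k) (Σ≤-cong k one-more)))
    where
    one-more : ∀ m → (ρ ≤v t) ⊙ (scale m ρ ≤v (t -v ρ)) ⊙ ways L ((t -v ρ) -v scale m ρ) (k ∸ m)
                   ≡ (scale (suc m) ρ ≤v t) ⊙ ways L (t -v scale (suc m) ρ) (k ∸ m)
    one-more m rewrite ⊙-∧ (ρ ≤v t) (scale m ρ ≤v (t -v ρ)) (ways L ((t -v ρ) -v scale m ρ) (k ∸ m))
                     | ≤v-+ ρ (scale m ρ) t | -v-+ ρ (scale m ρ) t | scale-suc m ρ = refl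

  count : {A : Set} → (A → Bool) → List A → ℕ
  count p xs = length (filterᵇ p xs)

  count-∷ : {A : Set} (p : A → Bool) → ∀ x xs → count p (x ∷ xs) ≡ p x ⊙ 1 + count p xs
  count-∷ p x xs with p x
  ... | true  = refl
  ... | false = refl

  count-++ : {A : Set} (p : A → Bool) → ∀ xs ys → count p (xs ++ ys) ≡ count p xs + count p ys
  count-++ p []       ys = refl
  count-++ p (x ∷ xs) ys =
    trans (count-∷ p x (xs ++ ys))
    (trans (cong (p x ⊙ 1 +_) (count-++ p xs ys))
    (trans (sym (+-assoc (p x ⊙ 1) _ _)) (cong (_+ count p ys) (sym (count-∷ p x xs)))))

  count-map : {A B : Set} (p : B → Bool) (f : A → B) → ∀ xs → count p (L.map f xs) ≡ count (λ x → p (f x)) xs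
  count-map p f []       = refl
  count-map p f (x ∷ xs) =
    trans (count-∷ p (f x) (L.map f xs))
    (trans (cong (p (f x) ⊙ 1 +_) (count-map p f xs)) (sym (count-∷ (λ x → p (f x)) x xs)))

  count-cong : {A : Set} {p q : A → Bool} → (∀ x → p x ≡ q x) → ∀ xs → count p xs ≡ count q xs
  count-cong e []       = refl
  count-cong {p = p} {q} e (x ∷ xs) =
    trans (count-∷ p x xs) (trans (cong₂ (λ b n → b ⊙ 1 + n) (e x) (count-cong e xs)) (sym (count-∷ q x xs)))

  count-guard : {A : Set} (b : Bool) (p : A → Bool) → ∀ xs → count (λ x → b ∧ p x) xs ≡ b ⊙ count p xs
  count-guard true  p xs       = refl
  count-guard false p []       = refl
  count-guard false p (x ∷ xs) = count-guard false p xs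

  count-boundedLists : (p : List ℕ → Bool) → ∀ n B →
    count p (boundedLists (suc n) B) ≡ Σ≤ B (λ m → count (λ ms → p (m ∷ ms)) (boundedLists n B))
  count-boundedLists p n B =
    trans (count-concatMap (upTo (suc B))) (sum-upTo B (λ m → count (λ ms → p (m ∷ ms)) (boundedLists n B)) (λ x → x))
    where
    count-concatMap : ∀ ms → count p (concatMap (λ m → L.map (m ∷_) (boundedLists n B)) ms)
                           ≡ sum (L.map (λ m → count (λ ms → p (m ∷ ms)) (boundedLists n B)) ms)
    count-concatMap []       = refl
    count-concatMap (m ∷ ms) =
      trans (count-++ p (L.map (m ∷_) (boundedLists n B)) _)
            (cong₂ _+_ (count-map p (m ∷_) (boundedLists n B)) (count-concatMap ms))
    sum-upTo : ∀ B (h g : ℕ → ℕ) → sum (L.map h (applyUpTo g (suc B))) ≡ Σ≤ B (λ m → h (g m))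
    sum-upTo zero    h g = +-identityʳ _
    sum-upTo (suc B) h g = cong (h (g 0) +_) (sum-upTo B h (λ m → g (suc m)))

  vecEq : Root r → Root r → Bool
  vecEq u v = ⌊ ≡-dec Nat._≟_ u v ⌋

  vecEq-∷ : ∀ x y (xs ys : Root r) → vecEq (x ∷ xs) (y ∷ ys) ≡ (x ≡ᵇ y) ∧ vecEq xs ys
  vecEq-∷ x y xs ys =
    trans (isYes≗does (≡-dec Nat._≟_ (x ∷ xs) (y ∷ ys))) (cong ((x ≡ᵇ y) ∧_) (sym (isYes≗does (≡-dec Nat._≟_ xs ys))))

  ≡ᵇ-+ : ∀ m s k → ((m + s) ≡ᵇ k) ≡ ((m ≤b k) ∧ (s ≡ᵇ (k ∸ m)))
  ≡ᵇ-+ zero    s k       = refl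
  ≡ᵇ-+ (suc m) s zero    = refl
  ≡ᵇ-+ (suc m) s (suc k) = ≡ᵇ-+ m s k

  vecEq-+ : (u c t : Root r) → vecEq (u +v c) t ≡ (u ≤v t) ∧ vecEq c (t -v u)
  vecEq-+ []       []       []       = refl
  vecEq-+ (a ∷ as) (c ∷ cs) (t ∷ ts) = begin
      vecEq (a + c ∷ as +v cs) (t ∷ ts)
    ≡⟨ vecEq-∷ (a + c) t (as +v cs) ts ⟩
      ((a + c) ≡ᵇ t) ∧ vecEq (as +v cs) ts
    ≡⟨ cong₂ _∧_ (≡ᵇ-+ a c t) (vecEq-+ as cs ts) ⟩
      ((a ≤b t) ∧ (c ≡ᵇ (t ∸ a))) ∧ ((as ≤v ts) ∧ vecEq cs (ts -v as))
    ≡⟨ ∧-interchange (a ≤b t) _ _ _ ⟩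
      ((a ≤b t) ∧ (as ≤v ts)) ∧ ((c ≡ᵇ (t ∸ a)) ∧ vecEq cs (ts -v as))
    ≡⟨ cong ((a ≤b t ∧ (as ≤v ts)) ∧_) (sym (vecEq-∷ c (t ∸ a) cs (ts -v as))) ⟩
      ((a ≤b t) ∧ (as ≤v ts)) ∧ vecEq (c ∷ cs) (t ∸ a ∷ ts -v as) ∎
    where open ≡-Reasoning

  vecEq-0 : (t : Root r) → vecEq (replicate r 0) t ≡ isZero t
  vecEq-0 []          = refl
  vecEq-0 {suc r} (zero  ∷ t) = trans (vecEq-∷ 0 0 (replicate r 0) t) (vecEq-0 t)
  vecEq-0 {suc r} (suc x ∷ t) = vecEq-∷ 0 (suc x) (replicate r 0) t

  isPartition : List (Root r) → Root r → ℕ → List ℕ → Bool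
  isPartition L t k ms = (sum ms ≡ᵇ k) ∧ vecEq (combine ms L) t

  count-isPartition : (L : List (Root r)) → ∀ B k t → k ≤ B →
    count (isPartition L t k) (boundedLists (length L) B) ≡ ways L t k
  count-isPartition []      B zero    t le =
    trans (count-∷ (isPartition [] t 0) [] []) (trans (+-identityʳ _) (cong (_⊙ 1) (vecEq-0 t)))
  count-isPartition []      B (suc k) t le = refl
  count-isPartition (ρ ∷ L) B k       t le = begin
      count (isPartition (ρ ∷ L) t k) (boundedLists (suc (length L)) B)
    ≡⟨ count-boundedLists (isPartition (ρ ∷ L) t k) (length L) B ⟩
      Σ≤ B (λ m → count (λ ms → isPartition (ρ ∷ L) t k (m ∷ ms)) (boundedLists (length L) B))
    ≡⟨ Σ≤-cong B with-multiplicity ⟩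
      Σ≤ B (λ m → (m ≤b k) ⊙ term m)
    ≡⟨ Σ≤-truncate B k term le ⟩
      Σ≤ k term
    ≡⟨ sym (ways-multiplicity ρ L t k) ⟩
      ways (ρ ∷ L) t k ∎
    where
    open ≡-Reasoning
    term : ℕ → ℕ
    term m = (scale m ρ ≤v t) ⊙ ways L (t -v scale m ρ) (k ∸ m)
    split : ∀ m ms → isPartition (ρ ∷ L) t k (m ∷ ms)
                   ≡ ((m ≤b k) ∧ (scale m ρ ≤v t)) ∧ isPartition L (t -v scale m ρ) (k ∸ m) ms
    split m ms = trans (cong₂ _∧_ (≡ᵇ-+ m (sum ms) k) (vecEq-+ (scale m ρ) (combine ms L) t))
                       (∧-interchange (m ≤b k) _ _ _)
    with-multiplicity : ∀ m → count (λ ms → isPartition (ρ ∷ L) t k (m ∷ ms)) (boundedLists (length L) B)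
                            ≡ (m ≤b k) ⊙ term m
    with-multiplicity m =
      trans (count-cong (split m) (boundedLists (length L) B))
      (trans (count-guard ((m ≤b k) ∧ (scale m ρ ≤v t)) _ (boundedLists (length L) B))
      (trans (cong (((m ≤b k) ∧ (scale m ρ ≤v t)) ⊙_)
                   (count-isPartition L B (k ∸ m) (t -v scale m ρ) (≤-trans (m∸n≤m k m) le)))
      (sym (⊙-∧ (m ≤b k) _ _))))

  partitionCount≡ways : ∀ r k → partitionCount r k ≡ ways (positiveRoots r) (highestRoot r) k
  partitionCount≡ways r k = count-isPartition (positiveRoots r) k k (highestRoot r) ≤-refl

  highest : ∀ n → Root (suc n)
  highest zero    = 1 ∷ []
  highest (suc n) = 2 ∷ highest n

  -- The roots of C_{n+1} with positive α₁-coefficient: α₁ + γ for γ = 0 or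
  -- γ a root of C_n (on α₂..α_{n+1}) with positive α₂-coefficient, and the
  -- highest root.
  leading : ∀ n → List (Root (suc n))
  leading zero    = (1 ∷ []) ∷ []
  leading (suc n) = L.map (1 ∷_) (0v ∷ leading n) ++ highest (suc n) ∷ []

  -- The positive roots of C_{n+1}, listed by the first simple root they involve.
  roots : ∀ n → List (Root (suc n))
  roots zero    = (1 ∷ []) ∷ []
  roots (suc n) = leading (suc n) ++ L.map (0 ∷_) (roots n)

  highestRoot≡highest : ∀ n → highestRoot (suc n) ≡ highest n
  highestRoot≡highest zero    = refl
  highestRoot≡highest (suc n) = cong (2 ∷_) (highestRoot≡highest n)

  range-shift : ∀ a b → range (suc a) (suc b) ≡ L.map suc (range a b)
  range-shift a b = map-∘ (upTo (suc b ∸ a))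

  range-cons : ∀ a m → range a (a + m) ≡ a ∷ range (suc a) (a + m)
  range-cons zero    m = cong (0 ∷_) (trans (map-id _) (sym (map-upTo suc m)))
  range-cons (suc a) m =
    trans (range-shift a (a + m))
    (trans (cong (L.map suc) (range-cons a m)) (cong (suc a ∷_) (sym (range-shift (suc a) (a + m)))))

  root₁-lift : ∀ r i j → root₁ (suc r) (suc (suc i)) (suc j) ≡ 0 ∷ root₁ r (suc i) j
  root₁-lift r i j = refl

  root₂-lift : ∀ r i j → root₂ (suc (suc r)) (suc (suc i)) (suc (suc j)) ≡ 0 ∷ root₂ (suc r) (suc i) (suc j)
  root₂-lift r i j = refl

  root₃-lift : ∀ r i → root₃ (suc (suc r)) (suc (suc i)) ≡ 0 ∷ root₃ (suc r) (suc i)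
  root₃-lift r i = refl

  roots₁ roots₂ roots₃ : ∀ r → List (Root r)
  roots₁ r = concatMap (λ i → L.map (λ j → root₁ r i j) (range i r)) (range 1 r)
  roots₂ r = concatMap (λ i → L.map (λ j → root₂ r i j) (range (suc i) (r ∸ 1))) (range 1 (r ∸ 1))
  roots₃ r = L.map (λ i → root₃ r i) (range 1 (r ∸ 1))

  first₁ first₂ : ∀ n → List (Root (suc (suc n)))
  first₁ n = L.map (root₁ (suc (suc n)) 1) (range 1 (suc (suc n)))
  first₂ n = L.map (λ j → root₂ (suc (suc n)) 1 (suc j)) (range 1 n)

  map-prefix : ∀ {m} c (f : ℕ → Root (suc m)) (g : ℕ → Root m) → (∀ j → f (suc j) ≡ c ∷ g j)
             → ∀ xs → L.map f (L.map suc xs) ≡ L.map (c ∷_) (L.map g xs)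
  map-prefix c f g e xs = trans (sym (map-∘ xs)) (trans (map-cong e xs) (map-∘ xs))

  lift-blocks : ∀ {m} (F : ℕ → List (Root (suc m))) (G : ℕ → List (Root m))
              → (∀ i → F (suc (suc i)) ≡ L.map (0 ∷_) (G (suc i)))
              → ∀ xs → concatMap F (L.map suc (L.map suc xs)) ≡ L.map (0 ∷_) (concatMap G (L.map suc xs))
  lift-blocks F G e xs = begin
      concatMap F (L.map suc (L.map suc xs))
    ≡⟨ concatMap-map F suc (L.map suc xs) ⟩
      concatMap (F ∘ suc) (L.map suc xs)
    ≡⟨ concatMap-map (F ∘ suc) suc xs ⟩
      concatMap (F ∘ suc ∘ suc) xs
    ≡⟨ concatMap-cong e xs ⟩
      concatMap (L.map (0 ∷_) ∘ G ∘ suc) xs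
    ≡⟨ map-concatMap (0 ∷_) (G ∘ suc) xs ⟨
      L.map (0 ∷_) (concatMap (G ∘ suc) xs)
    ≡⟨ cong (L.map (0 ∷_)) (concatMap-map G suc xs) ⟨
      L.map (0 ∷_) (concatMap G (L.map suc xs)) ∎
    where open ≡-Reasoning

  range₁ : ∀ b → range 1 (suc b) ≡ L.map suc (range 0 b)
  range₁ = range-shift 0

  range₂ : ∀ b → range 2 (suc (suc b)) ≡ L.map suc (L.map suc (range 0 b))
  range₂ b = trans (range-shift 1 (suc b)) (cong (L.map suc) (range₁ b))

  roots₁-split : ∀ n → roots₁ (suc (suc n)) ≡ first₁ n ++ L.map (0 ∷_) (roots₁ (suc n))
  roots₁-split n = begin
      concatMap F (range 1 (suc (suc n)))
    ≡⟨ cong (concatMap F) (trans (range-cons 1 (suc n)) (cong (1 ∷_) (range₂ n))) ⟩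
      F 1 ++ concatMap F (L.map suc (L.map suc (range 0 n)))
    ≡⟨ cong (F 1 ++_) (lift-blocks F G block (range 0 n)) ⟩
      F 1 ++ L.map (0 ∷_) (concatMap G (L.map suc (range 0 n)))
    ≡⟨ cong (λ xs → F 1 ++ L.map (0 ∷_) (concatMap G xs)) (sym (range₁ n)) ⟩
      first₁ n ++ L.map (0 ∷_) (roots₁ (suc n)) ∎
    where
    open ≡-Reasoning
    F : ℕ → List (Root (suc (suc n)))
    F i = L.map (root₁ (suc (suc n)) i) (range i (suc (suc n)))
    G : ℕ → List (Root (suc n))
    G i = L.map (root₁ (suc n) i) (range i (suc n))
    block : ∀ i → F (suc (suc i)) ≡ L.map (0 ∷_) (G (suc i))
    block i = trans (cong (L.map _) (range-shift (suc i) (suc n)))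
                    (map-prefix 0 _ _ (root₁-lift (suc n) i) (range (suc i) (suc n)))

  roots₂-split : ∀ n → roots₂ (suc (suc n)) ≡ first₂ n ++ L.map (0 ∷_) (roots₂ (suc n))
  roots₂-split zero    = refl
  roots₂-split (suc m) = begin
      concatMap F (range 1 (suc (suc m)))
    ≡⟨ cong (concatMap F) (trans (range-cons 1 (suc m)) (cong (1 ∷_) (range₂ m))) ⟩
      F 1 ++ concatMap F (L.map suc (L.map suc (range 0 m)))
    ≡⟨ cong₂ _++_ (trans (cong (L.map _) (range-shift 1 (suc m))) (sym (map-∘ (range 1 (suc m)))))
                  (lift-blocks F G block (range 0 m)) ⟩
      first₂ (suc m) ++ L.map (0 ∷_) (concatMap G (L.map suc (range 0 m)))
    ≡⟨ cong (λ xs → first₂ (suc m) ++ L.map (0 ∷_) (concatMap G xs)) (sym (range₁ m)) ⟩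
      first₂ (suc m) ++ L.map (0 ∷_) (roots₂ (suc (suc m))) ∎
    where
    open ≡-Reasoning
    F : ℕ → List (Root (suc (suc (suc m))))
    F i = L.map (root₂ (suc (suc (suc m))) i) (range (suc i) (suc (suc m)))
    G : ℕ → List (Root (suc (suc m)))
    G i = L.map (root₂ (suc (suc m)) i) (range (suc i) (suc m))
    block : ∀ i → F (suc (suc i)) ≡ L.map (0 ∷_) (G (suc i))
    block i = begin
        L.map (root₂ _ (suc (suc i))) (range (suc (suc (suc i))) (suc (suc m)))
      ≡⟨ cong (L.map _) (trans (range-shift (suc (suc i)) (suc m)) (cong (L.map suc) (range-shift (suc i) m))) ⟩
        L.map (root₂ _ (suc (suc i))) (L.map suc (L.map suc (range (suc i) m)))
      ≡⟨ sym (map-∘ _) ⟩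
        L.map (root₂ _ (suc (suc i)) ∘ suc) (L.map suc (range (suc i) m))
      ≡⟨ map-prefix 0 _ _ (root₂-lift (suc m) i) (range (suc i) m) ⟩
        L.map (0 ∷_) (L.map (root₂ (suc (suc m)) (suc i) ∘ suc) (range (suc i) m))
      ≡⟨ cong (L.map (0 ∷_)) (trans (map-∘ _) (cong (L.map _) (sym (range-shift (suc i) m)))) ⟩
        L.map (0 ∷_) (G (suc i)) ∎

  roots₃-split : ∀ n → roots₃ (suc (suc n)) ≡ highest (suc n) ∷ L.map (0 ∷_) (roots₃ (suc n))
  roots₃-split zero    = refl
  roots₃-split (suc m) = begin
      L.map f (range 1 (suc (suc m)))
    ≡⟨ cong (L.map f) (trans (range-cons 1 (suc m)) (cong (1 ∷_) (range₂ m))) ⟩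
      f 1 ∷ L.map f (L.map suc (L.map suc (range 0 m)))
    ≡⟨ cong₂ _∷_ (highestRoot≡highest (suc (suc m))) (sym (map-∘ (L.map suc (range 0 m)))) ⟩
      highest (suc (suc m)) ∷ L.map (f ∘ suc) (L.map suc (range 0 m))
    ≡⟨ cong (highest (suc (suc m)) ∷_) (map-prefix 0 (f ∘ suc) (g ∘ suc) (root₃-lift (suc m)) (range 0 m)) ⟩
      highest (suc (suc m)) ∷ L.map (0 ∷_) (L.map (g ∘ suc) (range 0 m))
    ≡⟨ cong (λ xs → highest (suc (suc m)) ∷ L.map (0 ∷_) xs) (trans (map-∘ (range 0 m)) (cong (L.map g) (sym (range₁ m)))) ⟩
      highest (suc (suc m)) ∷ L.map (0 ∷_) (roots₃ (suc (suc m))) ∎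
    where
    open ≡-Reasoning
    f : ℕ → Root (suc (suc (suc m)))
    f = root₃ (suc (suc (suc m)))
    g : ℕ → Root (suc (suc m))
    g = root₃ (suc (suc m))

  coeffs-zero : ∀ r → coeffs r (λ _ → 0) ≡ 0v
  coeffs-zero zero    = refl
  coeffs-zero (suc r) = cong (0 ∷_) (coeffs-zero r)

  first₁-rec : ∀ n → first₁ (suc n) ≡ (1 ∷ 0v) ∷ L.map (1 ∷_) (first₁ n)
  first₁-rec n =
    trans (cong (L.map f) (trans (range-cons 1 (suc (suc n))) (cong (1 ∷_) (range-shift 1 (suc (suc n))))))
          (cong₂ _∷_ (cong (1 ∷_) (coeffs-zero (suc (suc n))))
                     (map-prefix 1 f (root₁ (suc (suc n)) 1) (λ j → refl) (range 1 (suc (suc n)))))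
    where
    f : ℕ → Root (suc (suc (suc n)))
    f = root₁ (suc (suc (suc n))) 1

  first₂-rec : ∀ n → first₂ (suc n) ≡ (1 ∷ highest (suc n)) ∷ L.map (1 ∷_) (first₂ n)
  first₂-rec n =
    trans (cong (L.map f) (trans (range-cons 1 n) (cong (1 ∷_) (range-shift 1 n))))
          (cong₂ _∷_ (cong (1 ∷_) (highestRoot≡highest (suc n)))
                     (map-prefix 1 f (λ j → root₂ (suc (suc n)) 1 (suc j)) (λ j → refl) (range 1 n)))
    where
    f : ℕ → Root (suc (suc (suc n)))
    f j = root₂ (suc (suc (suc n))) 1 (suc j)

  leading↭firsts : ∀ n → leading (suc n) ↭ first₁ n ++ first₂ n ++ highest (suc n) ∷ []
  leading↭firsts zero    = ↭-refl
  leading↭firsts (suc m) = begin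
      ((1 ∷ 0v) ∷ L.map (1 ∷_) (leading (suc m))) ++ h ∷ []
    ↭⟨ ++⁺ʳ (h ∷ []) (Perm.prep (1 ∷ 0v) (map⁺ (1 ∷_) (leading↭firsts m))) ⟩
      ((1 ∷ 0v) ∷ L.map (1 ∷_) (first₁ m ++ first₂ m ++ highest (suc m) ∷ [])) ++ h ∷ []
    ≡⟨ cong (λ xs → ((1 ∷ 0v) ∷ xs) ++ h ∷ [])
         (trans (map-++ (1 ∷_) (first₁ m) _) (cong (F₁ ++_) (map-++ (1 ∷_) (first₂ m) _))) ⟩
      (1 ∷ 0v) ∷ ((F₁ ++ F₂ ++ (1 ∷ highest (suc m)) ∷ []) ++ h ∷ [])
    ≡⟨ cong ((1 ∷ 0v) ∷_) (trans (++-assoc F₁ _ _) (cong (F₁ ++_) (++-assoc F₂ _ _))) ⟩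
      (1 ∷ 0v) ∷ (F₁ ++ F₂ ++ (1 ∷ highest (suc m)) ∷ h ∷ [])
    ↭⟨ Perm.prep (1 ∷ 0v) (++⁺ˡ F₁ (shift (1 ∷ highest (suc m)) F₂ (h ∷ []))) ⟩
      (1 ∷ 0v) ∷ (F₁ ++ ((1 ∷ highest (suc m)) ∷ F₂) ++ h ∷ [])
    ≡⟨ cong₂ _++_ (first₁-rec m) (cong (_++ h ∷ []) (first₂-rec m)) ⟨
      first₁ (suc m) ++ first₂ (suc m) ++ h ∷ [] ∎
    where
    open PermutationReasoning
    h = highest (suc (suc m))
    F₁ = L.map (1 ∷_) (first₁ m)
    F₂ = L.map (1 ∷_) (first₂ m)

  interleave : {A : Set} (a x b y c w : List A) → (a ++ x) ++ (b ++ y) ++ (c ++ w) ↭ (a ++ b ++ c) ++ (x ++ y ++ w)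
  interleave a x b y c w = begin
      (a ++ x) ++ (b ++ y) ++ (c ++ w)
    ≡⟨ trans (++-assoc a x _) (cong (λ t → a ++ x ++ t) (++-assoc b y _)) ⟩
      a ++ x ++ b ++ y ++ c ++ w
    ↭⟨ ++⁺ˡ a (shifts x b) ⟩
      a ++ b ++ x ++ y ++ c ++ w
    ≡⟨ cong (λ t → a ++ b ++ t) (sym (++-assoc x y _)) ⟩
      a ++ b ++ (x ++ y) ++ c ++ w
    ↭⟨ ++⁺ˡ a (++⁺ˡ b (shifts (x ++ y) c)) ⟩
      a ++ b ++ c ++ (x ++ y) ++ w
    ≡⟨ trans (cong (λ t → a ++ b ++ c ++ t) (++-assoc x y w))
             (sym (trans (++-assoc a (b ++ c) _) (cong (a ++_) (++-assoc b c _)))) ⟩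
      (a ++ b ++ c) ++ (x ++ y ++ w) ∎
    where open PermutationReasoning

  positiveRoots↭roots : ∀ n → positiveRoots (suc n) ↭ roots n
  positiveRoots↭roots zero    = ↭-refl
  positiveRoots↭roots (suc m) = begin
      roots₁ (suc (suc m)) ++ roots₂ (suc (suc m)) ++ roots₃ (suc (suc m))
    ≡⟨ cong₂ _++_ (roots₁-split m) (cong₂ _++_ (roots₂-split m) (roots₃-split m)) ⟩
      (first₁ m ++ z R₁) ++ (first₂ m ++ z R₂) ++ (highest (suc m) ∷ [] ++ z R₃)
    ↭⟨ interleave (first₁ m) (z R₁) (first₂ m) (z R₂) (highest (suc m) ∷ []) (z R₃) ⟩
      (first₁ m ++ first₂ m ++ highest (suc m) ∷ []) ++ (z R₁ ++ z R₂ ++ z R₃)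
    ≡⟨ cong ((first₁ m ++ first₂ m ++ highest (suc m) ∷ []) ++_)
           (trans (map-++ (0 ∷_) R₁ _) (cong (z R₁ ++_) (map-++ (0 ∷_) R₂ R₃))) ⟨
      (first₁ m ++ first₂ m ++ highest (suc m) ∷ []) ++ z (positiveRoots (suc m))
    ↭⟨ ++⁺ (↭-sym (leading↭firsts m)) (map⁺ (0 ∷_) (positiveRoots↭roots m)) ⟩
      leading (suc m) ++ z (roots m) ∎
    where
    open PermutationReasoning
    z : ∀ {r} → List (Root r) → List (Root (suc r))
    z = L.map (0 ∷_)
    R₁ = roots₁ (suc m)
    R₂ = roots₂ (suc m)
    R₃ = roots₃ (suc m)

  Σ∈ : {A : Set} → List A → (A → ℕ) → ℕ
  Σ∈ []       f = 0
  Σ∈ (x ∷ xs) f = f x + Σ∈ xs f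

  Σpairs : {A : Set} → List A → (A → A → ℕ) → ℕ
  Σpairs []       f = 0
  Σpairs (x ∷ xs) f = Σ∈ (x ∷ xs) (f x) + Σpairs xs f

  ⊙-Σ∈ : {A : Set} (b : Bool) (f : A → ℕ) (xs : List A) → b ⊙ Σ∈ xs f ≡ Σ∈ xs (λ x → b ⊙ f x)
  ⊙-Σ∈ true  f xs       = refl
  ⊙-Σ∈ false f []       = refl
  ⊙-Σ∈ false f (x ∷ xs) = ⊙-Σ∈ false f xs

  Σ∈-++ : {A : Set} (f : A → ℕ) (xs ys : List A) → Σ∈ (xs ++ ys) f ≡ Σ∈ xs f + Σ∈ ys f
  Σ∈-++ f []       ys = refl
  Σ∈-++ f (x ∷ xs) ys = trans (cong (f x +_) (Σ∈-++ f xs ys)) (sym (+-assoc (f x) _ _))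

  Σ∈-map : {A B : Set} (f : B → ℕ) (g : A → B) (xs : List A) → Σ∈ (L.map g xs) f ≡ Σ∈ xs (f ∘ g)
  Σ∈-map f g []       = refl
  Σ∈-map f g (x ∷ xs) = cong (f (g x) +_) (Σ∈-map f g xs)

  Σ∈-cong : {A : Set} {f g : A → ℕ} → (∀ x → f x ≡ g x) → (xs : List A) → Σ∈ xs f ≡ Σ∈ xs g
  Σ∈-cong e []       = refl
  Σ∈-cong e (x ∷ xs) = cong₂ _+_ (e x) (Σ∈-cong e xs)

  Σ∈-zero : {A : Set} {f : A → ℕ} → (∀ x → f x ≡ 0) → (xs : List A) → Σ∈ xs f ≡ 0
  Σ∈-zero e []       = refl
  Σ∈-zero e (x ∷ xs) = cong₂ _+_ (e x) (Σ∈-zero e xs)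

  Σ∈-+ : {A : Set} (f g : A → ℕ) (xs : List A) → Σ∈ xs (λ x → f x + g x) ≡ Σ∈ xs f + Σ∈ xs g
  Σ∈-+ f g []       = refl
  Σ∈-+ f g (x ∷ xs) = trans (cong (f x + g x +_) (Σ∈-+ f g xs)) (interchange (f x) (g x) _ _)
    where
    interchange : ∀ a b c d → a + b + (c + d) ≡ a + c + (b + d)
    interchange = ℕ-Solver.solve-∀

  Σpairs-map : {A B : Set} (g : A → B) (xs : List A) (f : B → B → ℕ)
             → Σpairs (L.map g xs) f ≡ Σpairs xs (λ a b → f (g a) (g b))
  Σpairs-map g []       f = refl
  Σpairs-map g (x ∷ xs) f = cong₂ (λ a b → (f (g x) (g x) + a) + b) (Σ∈-map (f (g x)) g xs) (Σpairs-map g xs f)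

  Σpairs-snoc : {A : Set} (xs : List A) (y : A) (f : A → A → ℕ)
              → Σpairs (xs ++ y ∷ []) f ≡ Σpairs xs f + Σ∈ xs (λ x → f x y) + (f y y + 0)
  Σpairs-snoc []       y f = +-identityʳ (f y y + 0)
  Σpairs-snoc (x ∷ xs) y f = begin
      Σ∈ (x ∷ xs ++ y ∷ []) (f x) + Σpairs (xs ++ y ∷ []) f
    ≡⟨ cong₂ _+_ (cong (f x x +_) (Σ∈-++ (f x) xs (y ∷ []))) (Σpairs-snoc xs y f) ⟩
      (f x x + (Σ∈ xs (f x) + (f x y + 0))) + (Σpairs xs f + Σ∈ xs (λ x → f x y) + (f y y + 0))
    ≡⟨ regroup (f x x) (Σ∈ xs (f x)) (f x y) (Σpairs xs f) (Σ∈ xs (λ x → f x y)) (f y y) ⟩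
      (f x x + Σ∈ xs (f x) + Σpairs xs f) + (f x y + Σ∈ xs (λ x → f x y)) + (f y y + 0) ∎
    where
    open ≡-Reasoning
    regroup : ∀ a b c d e g → (a + (b + (c + 0))) + (d + e + (g + 0)) ≡ (a + b + d) + (c + e) + (g + 0)
    regroup = ℕ-Solver.solve-∀

  Σpairs-cong : {A : Set} {f g : A → A → ℕ} → (∀ a b → f a b ≡ g a b) → (xs : List A) → Σpairs xs f ≡ Σpairs xs g
  Σpairs-cong e []       = refl
  Σpairs-cong e (x ∷ xs) = cong₂ _+_ (Σ∈-cong (e x) (x ∷ xs)) (Σpairs-cong e xs)

  -- The number of ways to complete a partition of t that already contains
  -- the parts a and b (in this order) with k further parts from L.
  pairRest : ∀ {r} → List (Root r) → ℕ → Root r → Root r → Root r → ℕ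
  pairRest L k t a b = (a ≤v t) ⊙ (b ≤v (t -v a)) ⊙ ways L ((t -v a) -v b) k

  pairRest-0vˡ : ∀ {r} (L : List (Root r)) k t b → pairRest L k t 0v b ≡ (b ≤v t) ⊙ ways L (t -v b) k
  pairRest-0vˡ L k t b rewrite 0v-≤v t | -v-0v t = refl

  pairRest-0vʳ : ∀ {r} (L : List (Root r)) k t a → pairRest L k t a 0v ≡ (a ≤v t) ⊙ ways L (t -v a) k
  pairRest-0vʳ L k t a rewrite 0v-≤v (t -v a) | -v-0v (t -v a) = refl

  ways-lift : ∀ {m} (R : List (Root m)) t k → ways (L.map (0 ∷_) R) (0 ∷ t) k ≡ ways R t k
  ways-lift []      t zero    = refl
  ways-lift []      t (suc k) = refl
  ways-lift (ρ ∷ R) t zero    = ways-lift R t zero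
  ways-lift (ρ ∷ R) t (suc k) = cong₂ _+_ (ways-lift R t (suc k)) (cong ((ρ ≤v t) ⊙_) (ways-lift (ρ ∷ R) (t -v ρ) k))

  ways-lift-pos : ∀ {m} (R : List (Root m)) c t k → ways (L.map (0 ∷_) R) (suc c ∷ t) k ≡ 0
  ways-lift-pos []      c t zero    = refl
  ways-lift-pos []      c t (suc k) = refl
  ways-lift-pos (ρ ∷ R) c t zero    = ways-lift-pos R c t zero
  ways-lift-pos (ρ ∷ R) c t (suc k) =
    cong₂ _+_ (ways-lift-pos R c t (suc k)) (trans (cong ((ρ ≤v t) ⊙_) (ways-lift-pos (ρ ∷ R) c (t -v ρ) k)) (⊙-0 _))

  ways-skip : ∀ {m} a (ρ : Root m) L t k → ways ((suc a ∷ ρ) ∷ L) (0 ∷ t) k ≡ ways L (0 ∷ t) k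
  ways-skip a ρ L t zero    = refl
  ways-skip a ρ L t (suc k) = +-identityʳ _

  -- Root lists of C_{m+1} of the shape of `roots`: the roots 1 ∷ a for a in a
  -- list A of "tails", the root 2 ∷ h, and the lifted roots of C_m.  Parts are
  -- sorted by the α₁-coefficient of the target (0, 1 or 2).
  module FirstCoefficient {m : ℕ} (h : Root m) (R : List (Root m)) where

    withTails : List (Root m) → List (Root (suc m))
    withTails A = L.map (1 ∷_) A ++ (2 ∷ h) ∷ L.map (0 ∷_) R

    -- coefficient 0: only the lifted roots of C_m can be used
    ways-0∷ : ∀ A t k → ways (withTails A) (0 ∷ t) k ≡ ways R t k
    ways-0∷ []      t k = trans (ways-skip 1 h (L.map (0 ∷_) R) t k) (ways-lift R t k)
    ways-0∷ (a ∷ A) t k = trans (ways-skip 0 a (withTails A) t k) (ways-0∷ A t k)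

    -- coefficient 1: exactly one part 1 ∷ a, with a among the tails
    ways-1∷ : ∀ A t k → ways (withTails A) (1 ∷ t) (suc k) ≡ Σ∈ A (λ a → (a ≤v t) ⊙ ways R (t -v a) k)
    ways-1∷ []      t k = cong (_+ 0) (ways-lift-pos R 0 t (suc k))
    ways-1∷ (a ∷ A) t k = trans (+-comm (ways (withTails A) (1 ∷ t) (suc k)) _)
      (cong₂ _+_ (cong ((a ≤v t) ⊙_) (ways-0∷ (a ∷ A) (t -v a) k)) (ways-1∷ A t k))

    -- coefficient 2 with a single part: it must be 2 ∷ h
    ways-2∷-single : ∀ A t → ways (withTails A) (2 ∷ t) 1 ≡ (h ≤v t) ⊙ ways R (t -v h) 0
    ways-2∷-single []      t =
      cong₂ _+_ (ways-lift-pos R 1 t 1)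
        (cong ((h ≤v t) ⊙_) (trans (ways-skip 1 h (L.map (0 ∷_) R) (t -v h) 0) (ways-lift R (t -v h) 0)))
    ways-2∷-single (a ∷ A) t =
      trans (cong₂ _+_ (ways-2∷-single A t)
              (trans (cong ((a ≤v t) ⊙_) (ways-zero (withTails (a ∷ A)) (1 ∷ (t -v a)))) (⊙-0 _)))
            (+-identityʳ _)

    -- coefficient 2 with k + 2 parts: either the part 2 ∷ h, or two parts
    -- 1 ∷ a and 1 ∷ b for an unordered pair of tails
    ways-2∷ : ∀ A t k → ways (withTails A) (2 ∷ t) (suc (suc k))
                      ≡ (h ≤v t) ⊙ ways R (t -v h) (suc k) + Σpairs A (pairRest R k t)
    ways-2∷ []      t k =
      trans (cong₂ _+_ (ways-lift-pos R 1 t (suc (suc k)))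
              (cong ((h ≤v t) ⊙_) (trans (ways-skip 1 h (L.map (0 ∷_) R) (t -v h) (suc k)) (ways-lift R (t -v h) (suc k)))))
            (sym (+-identityʳ _))
    ways-2∷ (a ∷ A) t k = begin
        ways (withTails A) (2 ∷ t) (suc (suc k)) + (a ≤v t) ⊙ ways (withTails (a ∷ A)) (1 ∷ (t -v a)) (suc k)
      ≡⟨ cong₂ _+_ (ways-2∷ A t k) (cong ((a ≤v t) ⊙_) (ways-1∷ (a ∷ A) (t -v a) k)) ⟩
        (H + Σpairs A (pairRest R k t)) + (a ≤v t) ⊙ Σ∈ (a ∷ A) (λ b → (b ≤v (t -v a)) ⊙ ways R ((t -v a) -v b) k)
      ≡⟨ cong ((H + Σpairs A (pairRest R k t)) +_) (⊙-Σ∈ (a ≤v t) _ (a ∷ A)) ⟩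
        (H + Σpairs A (pairRest R k t)) + Σ∈ (a ∷ A) (pairRest R k t a)
      ≡⟨ +-assoc H _ _ ⟩
        H + (Σpairs A (pairRest R k t) + Σ∈ (a ∷ A) (pairRest R k t a))
      ≡⟨ cong (H +_) (+-comm (Σpairs A (pairRest R k t)) _) ⟩
        H + Σpairs (a ∷ A) (pairRest R k t) ∎
      where
      open ≡-Reasoning
      H = (h ≤v t) ⊙ ways R (t -v h) (suc k)

  -- Coefficient sequences in q: the unit δ₀ = 1 and multiplication by q.
  δ₀ : ℕ → ℕ
  δ₀ zero    = 1
  δ₀ (suc _) = 0

  sh : (ℕ → ℕ) → ℕ → ℕ
  sh f zero    = 0
  sh f (suc k) = f k

  tails : ∀ n → List (Root (suc n))
  tails n = 0v ∷ leading n

  roots-suc : ∀ n → roots (suc n) ≡ FirstCoefficient.withTails (highest n) (roots n) (tails n)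
  roots-suc n = ++-assoc (L.map (1 ∷_) (tails n)) (highest (suc n) ∷ []) (L.map (0 ∷_) (roots n))

  module _ (n : ℕ) where
    open FirstCoefficient (highest n) (roots n)

    ways-roots-0∷ : ∀ t k → ways (roots (suc n)) (0 ∷ t) k ≡ ways (roots n) t k
    ways-roots-0∷ t k = trans (cong (λ L → ways L (0 ∷ t) k) (roots-suc n)) (ways-0∷ (tails n) t k)

    ways-roots-1∷ : ∀ t k → ways (roots (suc n)) (1 ∷ t) (suc k)
                          ≡ Σ∈ (tails n) (λ a → (a ≤v t) ⊙ ways (roots n) (t -v a) k)
    ways-roots-1∷ t k = trans (cong (λ L → ways L (1 ∷ t) (suc k)) (roots-suc n)) (ways-1∷ (tails n) t k)

    ways-roots-2∷-single : ∀ t → ways (roots (suc n)) (2 ∷ t) 1 ≡ (highest n ≤v t) ⊙ ways (roots n) (t -v highest n) 0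
    ways-roots-2∷-single t = trans (cong (λ L → ways L (2 ∷ t) 1) (roots-suc n)) (ways-2∷-single (tails n) t)

    ways-roots-2∷ : ∀ t k → ways (roots (suc n)) (2 ∷ t) (suc (suc k))
                          ≡ (highest n ≤v t) ⊙ ways (roots n) (t -v highest n) (suc k)
                            + Σpairs (tails n) (pairRest (roots n) k t)
    ways-roots-2∷ t k = trans (cong (λ L → ways L (2 ∷ t) (suc (suc k))) (roots-suc n)) (ways-2∷ (tails n) t k)

  -- No positive root is 0, so 0 has only the empty partition.
  ways-roots-0v : ∀ n k → ways (roots n) 0v k ≡ δ₀ k
  ways-roots-0v zero    zero    = refl
  ways-roots-0v zero    (suc k) = refl
  ways-roots-0v (suc n) k       = trans (ways-roots-0∷ n 0v k) (ways-roots-0v n k)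

  -- P n k = a_k for C_{n+1}; W and O count the completions of the pairs of
  -- parts 1 ∷ a, 1 ∷ b of a partition of the highest root of C_{n+2}, over
  -- unordered and ordered pairs of tails respectively.
  P W O : ℕ → ℕ → ℕ
  P n k = ways (roots n) (highest n) k
  W n k = Σpairs (tails n) (pairRest (roots n) k (highest n))
  O n k = Σ∈ (tails n) (λ a → Σ∈ (tails n) (pairRest (roots n) k (highest n) a))

  isZero-highest : ∀ n → isZero (highest n) ≡ false
  isZero-highest zero    = refl
  isZero-highest (suc n) = refl

  P-zero : ∀ n → P n 0 ≡ 0
  P-zero n = trans (ways-zero (roots n) (highest n)) (cong (_⊙ 1) (isZero-highest n))

  -- P(n+1) = q + q² W(n): a partition of the highest root 2 ∷ h of C_{n+2}
  -- is either the root itself, or has two parts 1 ∷ a, 1 ∷ b.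
  P-rec : ∀ n k → P (suc n) k ≡ sh δ₀ k + sh (sh (W n)) k
  P-rec n zero          = P-zero (suc n)
  P-rec n (suc zero)    =
    trans (ways-roots-2∷-single n (highest n))
          (trans (cong₂ (λ b v → b ⊙ ways (roots n) v 0) (≤v-refl (highest n)) (-v-self (highest n)))
                 (ways-roots-0v n 0))
  P-rec n (suc (suc k)) =
    trans (ways-roots-2∷ n (highest n) k)
          (cong (_+ W n k) (trans (cong₂ (λ b v → b ⊙ ways (roots n) v (suc k)) (≤v-refl (highest n)) (-v-self (highest n)))
                                  (ways-roots-0v n (suc k))))

  Σ∈-tails : ∀ n (f : Root (suc (suc n)) → ℕ)
           → Σ∈ (tails (suc n)) f ≡ f 0v + (Σ∈ (tails n) (λ a → f (1 ∷ a)) + (f (highest (suc n)) + 0))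
  Σ∈-tails n f = cong (f 0v +_)
    (trans (Σ∈-++ f (L.map (1 ∷_) (tails n)) (highest (suc n) ∷ []))
           (cong (_+ (f (highest (suc n)) + 0)) (Σ∈-map f (1 ∷_) (tails n))))

  Σpairs-tails : ∀ n (f : Root (suc (suc n)) → Root (suc (suc n)) → ℕ)
               → Σpairs (tails (suc n)) f
               ≡ Σ∈ (tails (suc n)) (f 0v) + (Σpairs (tails n) (λ a b → f (1 ∷ a) (1 ∷ b))
                   + Σ∈ (tails n) (λ a → f (1 ∷ a) (highest (suc n))) + (f (highest (suc n)) (highest (suc n)) + 0))
  Σpairs-tails n f = cong (Σ∈ (tails (suc n)) (f 0v) +_)
    (trans (Σpairs-snoc (L.map (1 ∷_) (tails n)) (highest (suc n)) f)
           (cong₂ (λ x y → x + y + (f (highest (suc n)) (highest (suc n)) + 0)) (Σpairs-map (1 ∷_) (tails n) f) (Σ∈-map (λ x → f x (highest (suc n))) (1 ∷_) (tails n))))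

  one-tail : ∀ n k → Σ∈ (tails n) (λ b → (b ≤v highest n) ⊙ ways (roots (suc n)) (1 ∷ (highest n -v b)) k)
                   ≡ sh (O n) k
  one-tail n zero    = Σ∈-zero (λ b → trans (cong ((b ≤v highest n) ⊙_) (ways-zero (roots (suc n)) (1 ∷ (highest n -v b))))
                                            (⊙-0 (b ≤v highest n))) (tails n)
  one-tail n (suc k) = Σ∈-cong (λ b → trans (cong ((b ≤v highest n) ⊙_) (ways-roots-1∷ n (highest n -v b) k))
                                            (⊙-Σ∈ (b ≤v highest n) _ (tails n))) (tails n)

  module PairKinds (n k : ℕ) where
    h  = highest n
    h′ = highest (suc n)
    G : Root (suc (suc n)) → Root (suc (suc n)) → ℕ
    G = pairRest (roots (suc n)) k h′

    G-0-0 : G 0v 0v ≡ P (suc n) k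
    G-0-0 = trans (pairRest-0vˡ (roots (suc n)) k h′ 0v) (cong₂ (λ b v → b ⊙ ways (roots (suc n)) v k) (0v-≤v h′) (-v-0v h′))

    G-0-1 : ∀ b → G 0v (1 ∷ b) ≡ (b ≤v h) ⊙ ways (roots (suc n)) (1 ∷ (h -v b)) k
    G-0-1 b = pairRest-0vˡ (roots (suc n)) k h′ (1 ∷ b)

    G-1-0 : ∀ a → G (1 ∷ a) 0v ≡ (a ≤v h) ⊙ ways (roots (suc n)) (1 ∷ (h -v a)) k
    G-1-0 a = pairRest-0vʳ (roots (suc n)) k h′ (1 ∷ a)

    highest-alone : ∀ b → (b ≡ true) → b ⊙ ways (roots (suc n)) (h′ -v h′) k ≡ δ₀ k
    highest-alone b refl = trans (cong (λ v → ways (roots (suc n)) v k) (-v-self h′)) (ways-roots-0v (suc n) k)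

    G-0-h : G 0v h′ ≡ δ₀ k
    G-0-h = trans (pairRest-0vˡ (roots (suc n)) k h′ h′) (highest-alone (h′ ≤v h′) (≤v-refl h′))

    G-h-0 : G h′ 0v ≡ δ₀ k
    G-h-0 = trans (pairRest-0vʳ (roots (suc n)) k h′ h′) (highest-alone (h′ ≤v h′) (≤v-refl h′))

    G-1-1 : ∀ a b → G (1 ∷ a) (1 ∷ b) ≡ pairRest (roots n) k h a b
    G-1-1 a b = cong (λ x → (a ≤v h) ⊙ (b ≤v (h -v a)) ⊙ x) (ways-roots-0∷ n ((h -v a) -v b) k)

    -- the α₁-coefficients of two parts other than these exceed 2
    G-1-h : ∀ a → G (1 ∷ a) h′ ≡ 0
    G-1-h a = ⊙-0 (a ≤v h)

    G-h-1 : ∀ b → G h′ (1 ∷ b) ≡ 0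
    G-h-1 b = ⊙-0 (h′ ≤v h′)

    G-h-h : G h′ h′ ≡ 0
    G-h-h = ⊙-0 (h′ ≤v h′)

    pairs-from-0 : Σ∈ (tails (suc n)) (G 0v) ≡ P (suc n) k + (sh (O n) k + (δ₀ k + 0))
    pairs-from-0 = trans (Σ∈-tails n (G 0v))
      (cong₂ _+_ G-0-0 (cong₂ _+_ (trans (Σ∈-cong G-0-1 (tails n)) (one-tail n k)) (cong (_+ 0) G-0-h)))

  -- W(n+1) = P(n+1) + q O(n) + 1 + W(n): unordered pairs of tails of C_{n+3}
  -- sorted by the kinds of their members.
  W-rec : ∀ n k → W (suc n) k ≡ P (suc n) k + sh (O n) k + δ₀ k + W n k
  W-rec n k = begin
      Σpairs (tails (suc n)) G
    ≡⟨ Σpairs-tails n G ⟩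
      Σ∈ (tails (suc n)) (G 0v) + (Σpairs (tails n) (λ a b → G (1 ∷ a) (1 ∷ b))
        + Σ∈ (tails n) (λ a → G (1 ∷ a) h′) + (G h′ h′ + 0))
    ≡⟨ cong₂ _+_ pairs-from-0 (cong₂ (λ x y → x + y + (G h′ h′ + 0)) (Σpairs-cong G-1-1 (tails n)) (Σ∈-zero G-1-h (tails n))) ⟩
      (P (suc n) k + (sh (O n) k + (δ₀ k + 0))) + (W n k + 0 + (G h′ h′ + 0))
    ≡⟨ cong (λ x → (P (suc n) k + (sh (O n) k + (δ₀ k + 0))) + (W n k + 0 + (x + 0))) G-h-h ⟩
      (P (suc n) k + (sh (O n) k + (δ₀ k + 0))) + (W n k + 0 + (0 + 0))
    ≡⟨ regroup (P (suc n) k) (sh (O n) k) (δ₀ k) (W n k) ⟩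
      P (suc n) k + sh (O n) k + δ₀ k + W n k ∎
    where
    open ≡-Reasoning
    open PairKinds n k
    regroup : ∀ p s d w → (p + (s + (d + 0))) + (w + 0 + (0 + 0)) ≡ p + s + d + w
    regroup = ℕ-Solver.solve-∀

  O-rec : ∀ n k → O (suc n) k ≡ P (suc n) k + (sh (O n) k + sh (O n) k) + (δ₀ k + δ₀ k) + O n k
  O-rec n k = begin
      Σ∈ (tails (suc n)) (λ a → Σ∈ (tails (suc n)) (G a))
    ≡⟨ Σ∈-tails n (λ a → Σ∈ (tails (suc n)) (G a)) ⟩
      Σ∈ (tails (suc n)) (G 0v) + (Σ∈ (tails n) (λ a → Σ∈ (tails (suc n)) (G (1 ∷ a))) + (Σ∈ (tails (suc n)) (G h′) + 0))
    ≡⟨ cong₂ _+_ pairs-from-0 (cong₂ _+_ pairs-from-1s (cong (_+ 0) pairs-from-h)) ⟩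
      (P (suc n) k + (sh (O n) k + (δ₀ k + 0))) + ((sh (O n) k + O n k) + (δ₀ k + 0))
    ≡⟨ regroup (P (suc n) k) (sh (O n) k) (δ₀ k) (O n k) ⟩
      P (suc n) k + (sh (O n) k + sh (O n) k) + (δ₀ k + δ₀ k) + O n k ∎
    where
    open ≡-Reasoning
    open PairKinds n k
    regroup : ∀ p s d o → (p + (s + (d + 0))) + ((s + o) + (d + 0)) ≡ p + (s + s) + (d + d) + o
    regroup = ℕ-Solver.solve-∀
    pairs-from-1 : ∀ a → Σ∈ (tails (suc n)) (G (1 ∷ a))
                ≡ (a ≤v h) ⊙ ways (roots (suc n)) (1 ∷ (h -v a)) k + Σ∈ (tails n) (pairRest (roots n) k h a)
    pairs-from-1 a = trans (Σ∈-tails n (G (1 ∷ a)))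
      (cong₂ _+_ (G-1-0 a) (trans (cong₂ _+_ (Σ∈-cong (G-1-1 a) (tails n)) (cong (_+ 0) (G-1-h a))) (+-identityʳ _)))
    pairs-from-1s : Σ∈ (tails n) (λ a → Σ∈ (tails (suc n)) (G (1 ∷ a))) ≡ sh (O n) k + O n k
    pairs-from-1s = trans (Σ∈-cong pairs-from-1 (tails n))
      (trans (Σ∈-+ (λ a → (a ≤v h) ⊙ ways (roots (suc n)) (1 ∷ (h -v a)) k)
                   (λ a → Σ∈ (tails n) (pairRest (roots n) k h a)) (tails n))
             (cong (_+ O n k) (one-tail n k)))
    pairs-from-h : Σ∈ (tails (suc n)) (G h′) ≡ δ₀ k
    pairs-from-h = trans (Σ∈-tails n (G h′))
      (trans (cong₂ _+_ G-h-0 (cong₂ _+_ (Σ∈-zero G-h-1 (tails n)) (cong (_+ 0) G-h-h))) (+-identityʳ (δ₀ k)))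

  partitionCount≡P : ∀ m k → partitionCount (suc m) k ≡ P m k
  partitionCount≡P m k = begin
      partitionCount (suc m) k
    ≡⟨ partitionCount≡ways (suc m) k ⟩
      ways (positiveRoots (suc m)) (highestRoot (suc m)) k
    ≡⟨ ways-↭ (positiveRoots↭roots m) (highestRoot (suc m)) k ⟩
      ways (roots m) (highestRoot (suc m)) k
    ≡⟨ cong (λ t → ways (roots m) t k) (highestRoot≡highest m) ⟩
      P m k ∎
    where open ≡-Reasoning

module GeneratingFunction where

  open Counting using (P; W; O; δ₀; sh; P-zero; P-rec; W-rec; O-rec; partitionCount≡P)
  open import Data.Nat as Nat using (ℕ; zero; suc; _∸_; _≤_; z≤n; s≤s)
  open import Data.Nat.Properties using (+-∸-assoc; n∸n≡0; m≤n⇒m≤1+n; ≤-refl)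
  open import Data.Integer using (ℤ; +_; -_; _+_; _-_; _*_)
  open import Data.Integer.Properties using (pos-+; +-comm; +-identityˡ; +-identityʳ; *-zeroʳ)
  open import Data.Integer.Tactic.RingSolver using (solve-∀)
  open import Relation.Binary.PropositionalEquality

  Seq : Set
  Seq = ℕ → ℤ

  -- shift d f: multiplication by q^d.
  shift : ℕ → Seq → Seq
  shift zero    f         = f
  shift (suc d) f zero    = + 0
  shift (suc d) f (suc k) = shift d f k

  shift-cong : ∀ d {f g : Seq} → (∀ j → f j ≡ g j) → ∀ k → shift d f k ≡ shift d g k
  shift-cong zero    e k       = e k
  shift-cong (suc d) e zero    = refl
  shift-cong (suc d) e (suc k) = shift-cong d e k

  shift-+ : ∀ d (f g : Seq) k → shift d (λ j → f j + g j) k ≡ shift d f k + shift d g k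
  shift-+ zero    f g k       = refl
  shift-+ (suc d) f g zero    = refl
  shift-+ (suc d) f g (suc k) = shift-+ d f g k

  shift-shift : ∀ d e (f : Seq) k → shift d (shift e f) k ≡ shift (d Nat.+ e) f k
  shift-shift zero    e f k       = refl
  shift-shift (suc d) e f zero    = refl
  shift-shift (suc d) e f (suc k) = shift-shift d e f k

  shift-*ʳ : ∀ d (f : Seq) c k → shift d (λ j → f j * c) k ≡ shift d f k * c
  shift-*ʳ zero    f c k       = refl
  shift-*ʳ (suc d) f c zero    = refl
  shift-*ʳ (suc d) f c (suc k) = shift-*ʳ d f c k

  shift-+₄ : ∀ d {x a b c g : Seq} → (∀ j → x j ≡ a j + b j + c j + g j)
           → ∀ k → shift d x k ≡ shift d a k + shift d b k + shift d c k + shift d g k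
  shift-+₄ d {x} {a} {b} {c} {g} eq k =
    trans (shift-cong d eq k)
    (trans (shift-+ d (λ j → a j + b j + c j) g k)
           (cong (_+ shift d g k) (trans (shift-+ d (λ j → a j + b j) c k) (cong (_+ shift d c k) (shift-+ d a b k)))))

  lift : (ℕ → ℕ) → Seq
  lift f k = + f k

  lift-sh : ∀ f k → lift (sh f) k ≡ shift 1 (lift f) k
  lift-sh f zero    = refl
  lift-sh f (suc k) = refl

  lift-+₄ : ∀ a b c d → + (a Nat.+ b Nat.+ c Nat.+ d) ≡ + a + + b + + c + + d
  lift-+₄ a b c d = trans (pos-+ (a Nat.+ b Nat.+ c) d) (cong (_+ + d) (trans (pos-+ (a Nat.+ b) c) (cong (_+ + c) (pos-+ a b))))

  e : Seq
  e = lift δ₀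

  p w o : ℕ → Seq
  p n = lift (P n)
  w n = lift (W n)
  o n = lift (O n)

  recP : ∀ n k → p (suc n) k ≡ shift 1 e k + shift 2 (w n) k
  recP n k = begin
      + P (suc n) k
    ≡⟨ cong +_ (P-rec n k) ⟩
      + (sh δ₀ k Nat.+ sh (sh (W n)) k)
    ≡⟨ pos-+ (sh δ₀ k) _ ⟩
      + sh δ₀ k + + sh (sh (W n)) k
    ≡⟨ cong₂ _+_ (lift-sh δ₀ k) (trans (lift-sh (sh (W n)) k) (trans (shift-cong 1 (lift-sh (W n)) k) (shift-shift 1 1 (w n) k))) ⟩
      shift 1 e k + shift 2 (w n) k ∎
    where open ≡-Reasoning

  recW : ∀ n k → w (suc n) k ≡ p (suc n) k + shift 1 (o n) k + e k + w n k
  recW n k = trans (cong +_ (W-rec n k))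
    (trans (lift-+₄ (P (suc n) k) (sh (O n) k) (δ₀ k) (W n k)) (cong (λ x → p (suc n) k + x + e k + w n k) (lift-sh (O n) k)))

  recO : ∀ n k → o (suc n) k ≡ p (suc n) k + (shift 1 (o n) k + shift 1 (o n) k) + (e k + e k) + o n k
  recO n k = trans (cong +_ (O-rec n k))
    (trans (lift-+₄ (P (suc n) k) (sh (O n) k Nat.+ sh (O n) k) (δ₀ k Nat.+ δ₀ k) (O n k))
           (cong₂ (λ x y → p (suc n) k + x + y + o n k)
                  (trans (pos-+ (sh (O n) k) _) (cong₂ _+_ (lift-sh (O n) k) (lift-sh (O n) k)))
                  (pos-+ (δ₀ k) (δ₀ k))))

  -- Eliminating W: P(n+2) = (1 + q²) P(n+1) + q³ O(n) + q².
  P-step : ∀ n k → p (suc (suc n)) k ≡ p (suc n) k + shift 2 (p (suc n)) k + shift 3 (o n) k + shift 2 e k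
  P-step n k = begin
      p (suc (suc n)) k
    ≡⟨ recP (suc n) k ⟩
      shift 1 e k + shift 2 (w (suc n)) k
    ≡⟨ cong (λ x → shift 1 e k + x) (shift-+₄ 2 (recW n) k) ⟩
      shift 1 e k + (shift 2 (p (suc n)) k + shift 2 (shift 1 (o n)) k + shift 2 e k + shift 2 (w n) k)
    ≡⟨ cong (λ x → shift 1 e k + (shift 2 (p (suc n)) k + x + shift 2 e k + shift 2 (w n) k)) (shift-shift 2 1 (o n) k) ⟩
      shift 1 e k + (shift 2 (p (suc n)) k + shift 3 (o n) k + shift 2 e k + shift 2 (w n) k)
    ≡⟨ regroup (shift 1 e k) (shift 2 (p (suc n)) k) (shift 3 (o n) k) (shift 2 e k) (shift 2 (w n) k) ⟩
      (shift 1 e k + shift 2 (w n) k) + shift 2 (p (suc n)) k + shift 3 (o n) k + shift 2 e k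
    ≡⟨ cong (λ x → x + shift 2 (p (suc n)) k + shift 3 (o n) k + shift 2 e k) (recP n k) ⟨
      p (suc n) k + shift 2 (p (suc n)) k + shift 3 (o n) k + shift 2 e k ∎
    where
    open ≡-Reasoning
    regroup : ∀ a b c d x → a + (b + c + d + x) ≡ (a + x) + b + c + d
    regroup = solve-∀

  -- P(m+2) = (2 + 2q + q²) P(m+1) − (1 + 2q + q² + q³) P(m), the recurrence
  -- encoded by the denominator of the generating function.
  recurrence : ∀ m k → p (suc (suc m)) k
    ≡ + 2 * p (suc m) k + + 2 * shift 1 (p (suc m)) k + shift 2 (p (suc m)) k
      - (p m k + + 2 * shift 1 (p m) k + shift 2 (p m) k + shift 3 (p m) k)
  -- for m = 0, P(0), P(1), P(2) are explicit polynomials: direct computation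
  recurrence zero 0 = refl
  recurrence zero 1 = refl
  recurrence zero 2 = refl
  recurrence zero 3 = refl
  recurrence zero 4 = refl
  recurrence zero 5 = refl
  recurrence zero 6 = refl
  recurrence zero (suc (suc (suc (suc (suc (suc (suc k))))))) = refl
  recurrence (suc n) k = begin
      p (suc (suc (suc n))) k
    ≡⟨ P-step (suc n) k ⟩
      p₂ + s2p₂ + shift 3 (o (suc n)) k + s2e
    ≡⟨ cong₂ (λ x y → x + s2p₂ + y + s2e) (P-step n k) O-step ⟩
      (p₁ + s2p₁ + s3o + s2e) + s2p₂ + (s3p₁ + (s4o + s4o) + (s3e + s3e) + s3o) + s2e
    ≡⟨ eliminate p₁ s1p₁ s2p₁ s3p₁ s2p₂ s3o s4o s2e s3e ⟩
      + 2 * (p₁ + s2p₁ + s3o + s2e) + + 2 * (s1p₁ + s3p₁ + s4o + s3e) + s2p₂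
        - (p₁ + + 2 * s1p₁ + s2p₁ + s3p₁)
    ≡⟨ cong₂ (λ x y → + 2 * x + + 2 * y + s2p₂ - (p₁ + + 2 * s1p₁ + s2p₁ + s3p₁)) (P-step n k) P-step-q ⟨
      + 2 * p₂ + + 2 * shift 1 (p (suc (suc n))) k + s2p₂ - (p₁ + + 2 * s1p₁ + s2p₁ + s3p₁) ∎
    where
    open ≡-Reasoning
    p₁ s1p₁ s2p₁ s3p₁ p₂ s2p₂ s3o s4o s2e s3e : ℤ
    p₁   = p (suc n) k
    s1p₁ = shift 1 (p (suc n)) k
    s2p₁ = shift 2 (p (suc n)) k
    s3p₁ = shift 3 (p (suc n)) k
    p₂   = p (suc (suc n)) k
    s2p₂ = shift 2 (p (suc (suc n))) k
    s3o  = shift 3 (o n) k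
    s4o  = shift 4 (o n) k
    s2e  = shift 2 e k
    s3e  = shift 3 e k
    O-step : shift 3 (o (suc n)) k ≡ s3p₁ + (s4o + s4o) + (s3e + s3e) + s3o
    O-step = trans (shift-+₄ 3 (recO n) k)
      (cong₂ (λ x y → s3p₁ + x + y + s3o)
        (trans (shift-+ 3 (shift 1 (o n)) (shift 1 (o n)) k) (cong₂ _+_ (shift-shift 3 1 (o n) k) (shift-shift 3 1 (o n) k)))
        (shift-+ 3 e e k))
    P-step-q : shift 1 (p (suc (suc n))) k ≡ s1p₁ + s3p₁ + s4o + s3e
    P-step-q = trans (shift-+₄ 1 (P-step n) k)
      (trans (cong₂ (λ x y → s1p₁ + x + y + shift 1 (shift 2 e) k) (shift-shift 1 2 (p (suc n)) k) (shift-shift 1 3 (o n) k))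
             (cong (λ x → s1p₁ + s3p₁ + s4o + x) (shift-shift 1 2 e k)))
    eliminate : ∀ p₁ s1p₁ s2p₁ s3p₁ s2p₂ s3o s4o s2e s3e →
        (p₁ + s2p₁ + s3o + s2e) + s2p₂ + (s3p₁ + (s4o + s4o) + (s3e + s3e) + s3o) + s2e
      ≡ + 2 * (p₁ + s2p₁ + s3o + s2e) + + 2 * (s1p₁ + s3p₁ + s4o + s3e) + s2p₂
        - (p₁ + + 2 * s1p₁ + s2p₁ + s3p₁)
    eliminate = solve-∀

  Σ< : ℕ → (ℕ → ℤ) → ℤ
  Σ< zero    g = + 0
  Σ< (suc m) g = g 0 + Σ< m (λ d → g (suc d))

  Σ<-zero : ∀ m → Σ< m (λ _ → + 0) ≡ + 0
  Σ<-zero zero    = refl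
  Σ<-zero (suc m) = trans (+-identityˡ (Σ< m (λ _ → + 0))) (Σ<-zero m)

  Σ<-cong : ∀ m {g h : ℕ → ℤ} → (∀ d → g d ≡ h d) → Σ< m g ≡ Σ< m h
  Σ<-cong zero    e = refl
  Σ<-cong (suc m) e = cong₂ _+_ (e 0) (Σ<-cong m (λ d → e (suc d)))

  Σℤ-zero : ∀ n (g : ℕ → ℤ) → (∀ i → g i ≡ + 0) → Σℤ n g ≡ + 0
  Σℤ-zero zero    g z = z 0
  Σℤ-zero (suc n) g z = cong₂ _+_ (Σℤ-zero n g z) (z (suc n))

  Σℤ-cong≤ : ∀ n {g h : ℕ → ℤ} → (∀ i → i ≤ n → g i ≡ h i) → Σℤ n g ≡ Σℤ n h
  Σℤ-cong≤ zero    e = e 0 z≤n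
  Σℤ-cong≤ (suc n) e = cong₂ _+_ (Σℤ-cong≤ n (λ i le → e i (m≤n⇒m≤1+n le))) (e (suc n) ≤-refl)

  -- An anti-diagonal sum Σ_{i ≤ n} f i (n - i) whose terms vanish for n - i ≥ m
  -- has at most m terms: the one with n - i = d is (q^d-shifted f · d) at n.
  antidiagonal : ∀ m n (f : ℕ → ℕ → ℤ) → (∀ i d → m ≤ d → f i d ≡ + 0)
               → Σℤ n (λ i → f i (n ∸ i)) ≡ Σ< m (λ d → shift d (λ i → f i d) n)
  antidiagonal zero    n       f z = Σℤ-zero n _ (λ i → z i (n ∸ i) z≤n)
  antidiagonal (suc m) zero    f z = sym (trans (cong (λ x → f 0 0 + x) (Σ<-zero m)) (+-identityʳ (f 0 0)))
  antidiagonal (suc m) (suc n) f z = begin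
      Σℤ n (λ i → f i (suc n ∸ i)) + f (suc n) (n ∸ n)
    ≡⟨ cong₂ _+_ (Σℤ-cong≤ n (λ i le → cong (f i) (+-∸-assoc 1 le))) (cong (f (suc n)) (n∸n≡0 n)) ⟩
      Σℤ n (λ i → f i (suc (n ∸ i))) + f (suc n) 0
    ≡⟨ cong (_+ f (suc n) 0) (antidiagonal m n (λ i d → f i (suc d)) (λ i d le → z i (suc d) (s≤s le))) ⟩
      Σ< m (λ d → shift d (λ i → f i (suc d)) n) + f (suc n) 0
    ≡⟨ +-comm _ (f (suc n) 0) ⟩
      f (suc n) 0 + Σ< m (λ d → shift d (λ i → f i (suc d)) n) ∎
    where open ≡-Reasoning

  kostantSeries≡p : ∀ m k → kostantSeries (suc m) k ≡ p m k
  kostantSeries≡p m zero    = cong +_ (sym (P-zero m))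
  kostantSeries≡p m (suc k) = cong +_ (partitionCount≡P m (suc k))

  denominator-x-degree : ∀ d e → 3 ≤ d → denominator d e ≡ + 0
  denominator-x-degree (suc (suc (suc d))) e (s≤s (s≤s (s≤s _))) = refl

  denominator-q-degree : ∀ d e → 4 ≤ e → denominator d e ≡ + 0
  denominator-q-degree 0                   (suc (suc (suc (suc e)))) (s≤s (s≤s (s≤s (s≤s _)))) = refl
  denominator-q-degree 1                   (suc (suc (suc (suc e)))) (s≤s (s≤s (s≤s (s≤s _)))) = refl
  denominator-q-degree 2                   (suc (suc (suc (suc e)))) (s≤s (s≤s (s≤s (s≤s _)))) = refl
  denominator-q-degree (suc (suc (suc d))) (suc (suc (suc (suc e)))) (s≤s (s≤s (s≤s (s≤s _)))) = refl

  -- The coefficient of q^k in (x^i-coefficient of the series) · D_d(q), where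
  -- D_d(q) is the x^d-coefficient of the denominator.
  column : ℕ → ℕ → ℕ → ℤ
  column k i d = Σℤ k (λ j → kostantSeries i j * denominator d (k ∸ j))

  row : ℕ → ℕ → ℕ → ℤ
  row m d k = Σ< 4 (λ e → shift e (p m) k * denominator d e)

  -- Only the first four anti-diagonal terms survive, as D_d has degree ≤ 3.
  column≡row : ∀ m d k → column k (suc m) d ≡ row m d k
  column≡row m d k =
    trans (antidiagonal 4 k (λ j e → kostantSeries (suc m) j * denominator d e)
                       (λ j e le → trans (cong (kostantSeries (suc m) j *_) (denominator-q-degree d e le)) (*-zeroʳ (kostantSeries (suc m) j))))
          (Σ<-cong 4 (λ e → trans (shift-*ʳ e (kostantSeries (suc m)) (denominator d e) k)
                                  (cong (_* denominator d e) (shift-cong e (kostantSeries≡p m) k))))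

  column-x-degree : ∀ k i d → 3 ≤ d → column k i d ≡ + 0
  column-x-degree k i d le =
    Σℤ-zero k _ (λ j → trans (cong (kostantSeries i j *_) (denominator-x-degree d (k ∸ j) le)) (*-zeroʳ (kostantSeries i j)))

  column-0 : ∀ k d → column k 0 d ≡ + 0
  column-0 k d = Σℤ-zero k _ (λ j → refl)

  row-0 : ∀ m k → row m 0 k ≡ p m k
  row-0 m k = expand (p m k) (shift 1 (p m) k) (shift 2 (p m) k) (shift 3 (p m) k)
    where
    expand : ∀ a b c d → a * + 1 + (b * + 0 + (c * + 0 + (d * + 0 + + 0))) ≡ a
    expand = solve-∀

  row-1 : ∀ m k → row m 1 k ≡ - (+ 2 * p m k + + 2 * shift 1 (p m) k + shift 2 (p m) k)
  row-1 m k = expand (p m k) (shift 1 (p m) k) (shift 2 (p m) k) (shift 3 (p m) k)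
    where
    expand : ∀ a b c d → a * - (+ 2) + (b * - (+ 2) + (c * - (+ 1) + (d * + 0 + + 0))) ≡ - (+ 2 * a + + 2 * b + c)
    expand = solve-∀

  row-2 : ∀ m k → row m 2 k ≡ p m k + + 2 * shift 1 (p m) k + shift 2 (p m) k + shift 3 (p m) k
  row-2 m k = expand (p m k) (shift 1 (p m) k) (shift 2 (p m) k) (shift 3 (p m) k)
    where
    expand : ∀ a b c d → a * + 1 + (b * + 2 + (c * + 1 + (d * + 1 + + 0))) ≡ a + + 2 * b + c + d
    expand = solve-∀

  -- The coefficient of x^n q^k of the product: for n ≤ 2 by computation, and
  -- for n ≥ 3 it vanishes by the recurrence.
  coefficient : ∀ n k → Σ< 3 (λ d → shift d (λ i → column k i d) n) ≡ numerator n k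
  coefficient 0 k = cong (λ x → x + (+ 0 + (+ 0 + + 0))) (column-0 k 0)
  coefficient 1 k = trans (cong₂ (λ x y → x + (y + (+ 0 + + 0))) (column≡row 0 0 k) (column-0 k 1)) (initial k)
    where
    initial : ∀ k → row 0 0 k + (+ 0 + (+ 0 + + 0)) ≡ numerator 1 k
    initial 0 = refl
    initial 1 = refl
    initial 2 = refl
    initial 3 = refl
    initial 4 = refl
    initial (suc (suc (suc (suc (suc k))))) = refl
  coefficient 2 k =
    trans (cong₂ (λ x y → x + (y + (column k 0 2 + + 0))) (column≡row 1 0 k) (column≡row 0 1 k))
          (trans (cong (λ z → row 1 0 k + (row 0 1 k + (z + + 0))) (column-0 k 2)) (initial k))
    where
    initial : ∀ k → row 1 0 k + (row 0 1 k + (+ 0 + + 0)) ≡ numerator 2 k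
    initial 0 = refl
    initial 1 = refl
    initial 2 = refl
    initial 3 = refl
    initial 4 = refl
    initial 5 = refl
    initial 6 = refl
    initial (suc (suc (suc (suc (suc (suc (suc k))))))) = refl
  coefficient (suc (suc (suc m))) k = begin
      column k (suc (suc (suc m))) 0 + (column k (suc (suc m)) 1 + (column k (suc m) 2 + + 0))
    ≡⟨ cong₂ (λ x y → x + (y + (column k (suc m) 2 + + 0))) (column≡row (suc (suc m)) 0 k) (column≡row (suc m) 1 k) ⟩
      row (suc (suc m)) 0 k + (row (suc m) 1 k + (column k (suc m) 2 + + 0))
    ≡⟨ cong (λ z → row (suc (suc m)) 0 k + (row (suc m) 1 k + (z + + 0))) (column≡row m 2 k) ⟩
      row (suc (suc m)) 0 k + (row (suc m) 1 k + (row m 2 k + + 0))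
    ≡⟨ cong₂ (λ x y → x + (y + (row m 2 k + + 0))) (row-0 (suc (suc m)) k) (row-1 (suc m) k) ⟩
      p (suc (suc m)) k + (- A + (row m 2 k + + 0))
    ≡⟨ cong₂ (λ x y → x + (- A + (y + + 0))) (recurrence m k) (row-2 m k) ⟩
      (A - B) + (- A + (B + + 0))
    ≡⟨ cancel A B ⟩
      + 0 ∎
    where
    open ≡-Reasoning
    A B : ℤ
    A = + 2 * p (suc m) k + + 2 * shift 1 (p (suc m)) k + shift 2 (p (suc m)) k
    B = p m k + + 2 * shift 1 (p m) k + shift 2 (p m) k + shift 3 (p m) k
    cancel : ∀ a b → (a - b) + (- a + (b + + 0)) ≡ + 0
    cancel = solve-∀

open GeneratingFunction using (antidiagonal; column; column-x-degree; coefficient)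

-- The product is an anti-diagonal sum of columns, of which only those for
-- x⁰, x¹, x² of the denominator are nonzero; these are evaluated by
-- 'coefficient'.
theorem4p3 : (n k : ℕ) → (kostantSeries ⊛ denominator) n k ≡ numerator n k
theorem4p3 n k = trans (antidiagonal 3 n (column k) (column-x-degree k)) (coefficient n k)
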